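{- For every $\mathrm{FO}^{2+}[\mathfrak{B}_0]$ formula $\varphi(x)$ with one free variable $x$ there is a $\mathrm{UTL}^+$ formula $\psi$ such that for every word $u$ and position $i$ of $u$, $(u,[x\mapsto i])\models\varphi$ iff $u,i\models\psi$; and conversely, for every $\mathrm{UTL}^+$ formula $\psi$ there is an $\mathrm{FO}^{2+}[\mathfrak{B}_0]$ formula $\varphi(x)$ with one free variable with the same property. In other words, $\mathrm{FO}^{2+}[\mathfrak{B}_0]$ formulas with one free variable and $\mathrm{UTL}^+$ formulas describe the same languages.
   Context: Let $\Sigma$ be a finite set of unary predicates, alphabet $A=2^\Sigma$, words $u=u_0\cdots u_{m-1}$. $\mathfrak{B}_0=\{\le,<,\mathrm{succ},\mathrm{nsucc}\}$ (with $=$ and $\neq$ also available), interpreted on positions, $\mathrm{succ}(x,y)$ iff $y=x+1$, $\mathrm{nsucc}(x,y)$ iff $y\ne x+1$. $\mathrm{FO}^{2+}[\mathfrak{B}_0]$ is the set of first-order formulas built from $\bot,\top$, atoms $\beta(x,y)$ with $\beta\in\mathfrak{B}_0$ (or $=,\ne$), atoms $a(x)$ with $a\in\Sigma$ (true iff $a$ belongs to the letter at position $x$), $\wedge,\vee,\exists,\forall$, without negation, and using only two distinct variable names (reusable). $\mathrm{UTL}^+$ has grammar $\varphi,\psi::=\bot\mid\top\mid a\mid\varphi\wedge\psi\mid\varphi\vee\psi\mid\mathrm{X}\varphi\mid\mathrm{Y}\varphi\mid\mathrm{P}\varphi\mid\mathrm{F}\varphi\mid\mathrm{H}\varphi\mid\mathrm{G}\varphi$,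 evaluated at a position $i$ of $u$: $u,i\models a$ iff $a\in u_i$; $u,i\models\mathrm{X}\varphi$ iff $i+1<m$ and $u,i+1\models\varphi$; $u,i\models\mathrm{Y}\varphi$ iff $i\ge1$ and $u,i-1\models\varphi$; $\mathrm{F}\varphi$ (resp. $\mathrm{P}\varphi$) holds iff $\varphi$ holds at some position $j>i$ (resp. $j<i$); $\mathrm{G}\varphi$ (resp. $\mathrm{H}\varphi$) holds iff $\varphi$ holds at all positions $j>i$ (resp. $j<i$). -}

module Defs where

open import Data.Nat using (ℕ; suc)
open import Data.Bool using (Bool; true)
open import Data.Fin using (Fin; toℕ; _<_; _≤_)
open import Data.List using (List; length; lookup)
open import Data.Empty using (⊥)
open import Data.Unit using (⊤)
open import Data.Product using (Σ; _×_)
open import Data.Sum using (_⊎_)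
open import Relation.Binary.PropositionalEquality using (_≡_; _≢_)

-- Σ = Fin n (n unary predicates); a letter is a subset of Σ; a word is a list of letters.
Letter : ℕ → Set
Letter n = Fin n → Bool

Word : ℕ → Set
Word n = List (Letter n)

Pos : ∀ {n} → Word n → Set
Pos u = Fin (length u)

holds : ∀ {n} (u : Word n) → Fin n → Pos u → Set
holds u a i = lookup u i a ≡ true

data Var : Set where
  x y : Var

-- binary predicates of B0 together with = and ≠
data BinRel : Set where
  le lt succ nsucc eq neq : BinRel

⟦_⟧β : BinRel → ℕ → ℕ → Set
⟦ le ⟧β    i j = i Data.Nat.≤ j
⟦ lt ⟧β    i j = i Data.Nat.< j
⟦ succ ⟧β  i j = j ≡ suc i
⟦ nsucc ⟧β i j = j ≢ suc i
⟦ eq ⟧β    i j = i ≡ j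
⟦ neq ⟧β   i j = i ≢ j

data FO2 (n : ℕ) : Set where
  ⊥' ⊤' : FO2 n
  rel   : BinRel → Var → Var → FO2 n
  pred  : Fin n → Var → FO2 n
  _∧'_ _∨'_ : FO2 n → FO2 n → FO2 n
  ∃' ∀' : Var → FO2 n → FO2 n

data FreeIn {n : ℕ} (v : Var) : FO2 n → Set where
  rel₁ : ∀ {β w} → FreeIn v (rel β v w)
  rel₂ : ∀ {β w} → FreeIn v (rel β w v)
  pred : ∀ {a} → FreeIn v (pred a v)
  ∧₁ : ∀ {φ ψ} → FreeIn v φ → FreeIn v (φ ∧' ψ)
  ∧₂ : ∀ {φ ψ} → FreeIn v ψ → FreeIn v (φ ∧' ψ)
  ∨₁ : ∀ {φ ψ} → FreeIn v φ → FreeIn v (φ ∨' ψ)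
  ∨₂ : ∀ {φ ψ} → FreeIn v ψ → FreeIn v (φ ∨' ψ)
  ∃f : ∀ {w φ} → v ≢ w → FreeIn v φ → FreeIn v (∃' w φ)
  ∀f : ∀ {w φ} → v ≢ w → FreeIn v φ → FreeIn v (∀' w φ)

OneFree : ∀ {n} → FO2 n → Set
OneFree φ = FreeIn y φ → ⊥

update : ∀ {A : Set} → (Var → A) → Var → A → Var → A
update ρ x a x = a
update ρ x a y = ρ y
update ρ y a x = ρ x
update ρ y a y = a

Sat : ∀ {n} (u : Word n) → (Var → Pos u) → FO2 n → Set
Sat u ρ ⊥' = ⊥
Sat u ρ ⊤' = ⊤
Sat u ρ (rel β v w) = ⟦ β ⟧β (toℕ (ρ v)) (toℕ (ρ w))
Sat u ρ (pred a v) = holds u a (ρ v)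
Sat u ρ (φ ∧' ψ) = Sat u ρ φ × Sat u ρ ψ
Sat u ρ (φ ∨' ψ) = Sat u ρ φ ⊎ Sat u ρ ψ
Sat u ρ (∃' v φ) = Σ (Pos u) λ j → Sat u (update ρ v j) φ
Sat u ρ (∀' v φ) = (j : Pos u) → Sat u (update ρ v j) φ

data UTL (n : ℕ) : Set where
  ⊥' ⊤' : UTL n
  atom : Fin n → UTL n
  _∧'_ _∨'_ : UTL n → UTL n → UTL n
  X Y P F H G : UTL n → UTL n

Models : ∀ {n} (u : Word n) → Pos u → UTL n → Set
Models u i ⊥' = ⊥
Models u i ⊤' = ⊤
Models u i (atom a) = holds u a i
Models u i (φ ∧' ψ) = Models u i φ × Models u i ψ
Models u i (φ ∨' ψ) = Models u i φ ⊎ Models u i ψ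
Models u i (X φ) = Σ (Pos u) λ j → (toℕ j ≡ suc (toℕ i)) × Models u j φ
Models u i (Y φ) = Σ (Pos u) λ j → (toℕ i ≡ suc (toℕ j)) × Models u j φ
Models u i (P φ) = Σ (Pos u) λ j → (j < i) × Models u j φ
Models u i (F φ) = Σ (Pos u) λ j → (i < j) × Models u j φ
Models u i (H φ) = (j : Pos u) → j < i → Models u j φ
Models u i (G φ) = (j : Pos u) → i < j → Models u j φ

{-# OPTIONS --safe #-}
module Submission where

-- UTL⁺ embeds into FO²⁺ by the standard translation, alternating the two variables.
--
-- Conversely, fix the offset of y from x, identifying all distances ≥ 2.  The relations
-- of B0 cannot tell such distances apart, so relative to a fixed offset every atom of
-- φ(x, y) is a formula about x alone or about y alone.  Hence φ is equivalent both to a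
-- disjunction of conjunctions α(x) ∧ β(y) and to a conjunction of disjunctions
-- α(x) ∨ β(y) of UTL⁺ formulas; without negation both shapes have to be maintained.
-- ∃y distributes over the first and ∀y over the second, and "some / every y at offset c
-- satisfies β" is expressed with X, Y, F, P, G, H.  Pulling α(x) out of ∀y uses that
-- satisfaction of UTL⁺ formulas is decidable.

open import Defs
open import Data.Nat using (ℕ)
open import Data.Product using (Σ; _×_)
open import Function.Bundles using (_⇔_)

open import Level using (0ℓ)
open import Data.Nat as ℕ using (zero; suc; z≤n; s≤s; s≤s⁻¹; z<s; s<s; s<s⁻¹)
open import Data.Nat.Properties using (suc-injective; ≤-reflexive; ≤-<-trans; <⇒≤; <⇒≱; ≰⇒>)
open import Data.Fin as Fin using (Fin; toℕ; fromℕ<; inject₁)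
open import Data.Fin.Properties using (toℕ-fromℕ<; toℕ-inject₁; toℕ<n; toℕ-injective; any?; all?)
open import Data.Bool using (true)
import Data.Bool.Properties as Bool
open import Data.List using (List; []; _∷_; _++_; map; lookup; cartesianProductWith)
open import Data.List.Relation.Unary.Any as Any using (Any; here; there)
import Data.List.Relation.Unary.Any.Properties as Any
open import Data.List.Relation.Unary.All as All using (All; []; _∷_)
import Data.List.Relation.Unary.All.Properties as All
open import Data.Unit using (tt)
open import Data.Product using (_,_; curry; uncurry; swap)
import Data.Product.Function.Dependent.Propositional as Σ
open import Data.Product.Function.NonDependent.Propositional using (_×-cong_)
open import Data.Sum as Sum using (_⊎_; inj₁; inj₂; [_,_]′)
open import Data.Sum.Function.Propositional using (_⊎-cong_)
open import Function using (_∘_; id; case_of_)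
open import Function.Bundles using (mk⇔; module Equivalence)
open import Function.Properties.Equivalence using (⇔-setoid)
open import Function.Properties.Inverse using (↔⇒⇔)
open import Function.Related.TypeIsomorphisms using (¬-cong-⇔)
open import Relation.Binary.Bundles using (Setoid)
open import Relation.Binary.PropositionalEquality using (_≡_; _≢_; refl; sym; trans; cong; subst; subst₂)
open import Relation.Nullary using (Dec; yes; no; ¬_; contradiction)
open import Relation.Nullary.Decidable using (¬?; _×-dec_; _⊎-dec_; _→-dec_)
open import Relation.Unary using (Decidable)

module ⇔ = Setoid (⇔-setoid 0ℓ)
open Equivalence using (to; from)

Π-cong : ∀ {I : Set} {A B : I → Set} → (∀ i → A i ⇔ B i) → ((i : I) → A i) ⇔ ((i : I) → B i)
Π-cong A⇔B = mk⇔ (λ f i → to (A⇔B i) (f i)) (λ g i → from (A⇔B i) (g i))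

∀-⊎-distribˡ : ∀ {I A : Set} {B : I → Set} → Dec A → (∀ i → A ⊎ B i) → A ⊎ (∀ i → B i)
∀-⊎-distribˡ (yes a) _ = inj₁ a
∀-⊎-distribˡ (no ¬a) h = inj₂ λ i → [ (λ a → contradiction a ¬a) , id ]′ (h i)

≤-⊎⇔<-→ : ∀ {A : Set} a b → (a ℕ.≤ b ⊎ A) ⇔ (b ℕ.< a → A)
≤-⊎⇔<-→ {A} a b = mk⇔ [ (λ a≤b b<a → contradiction a≤b (<⇒≱ b<a)) , (λ z _ → z) ]′ from′
  where
  from′ : (b ℕ.< a → A) → a ℕ.≤ b ⊎ A
  from′ h with a ℕ.≤? b
  ... | yes a≤b = inj₁ a≤b
  ... | no  a≰b = inj₂ (h (≰⇒> a≰b))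

next-or-last : ∀ {m} (i : Fin m) → (Σ (Fin m) λ k → toℕ k ≡ suc (toℕ i)) ⊎ (∀ (j : Fin m) → ¬ i Fin.< j)
next-or-last {m} i with suc (toℕ i) ℕ.<? m
... | yes 1+i<m = inj₁ (fromℕ< 1+i<m , toℕ-fromℕ< 1+i<m)
... | no  1+i≮m = inj₂ λ j i<j → 1+i≮m (≤-<-trans i<j (toℕ<n j))

prev-or-first : ∀ {m} (i : Fin m) → (Σ (Fin m) λ k → toℕ i ≡ suc (toℕ k)) ⊎ (∀ (j : Fin m) → ¬ j Fin.< i)
prev-or-first Fin.zero    = inj₂ λ _ ()
prev-or-first (Fin.suc i) = inj₁ (inject₁ i , cong suc (sym (toℕ-inject₁ i)))

next : ∀ {m} (i j : Fin m) → i Fin.< j → Σ (Fin m) λ k → toℕ k ≡ suc (toℕ i)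
next i j i<j = [ id , (λ last → contradiction i<j (last j)) ]′ (next-or-last i)

prev : ∀ {m} (i j : Fin m) → j Fin.< i → Σ (Fin m) λ k → toℕ i ≡ suc (toℕ k)
prev i j j<i = [ id , (λ first → contradiction j<i (first j)) ]′ (prev-or-first i)

module _ {A : Set} {P : A → Set} (_∙_ : A → A → A) where

  Any-cartesianProductWith : (∀ {a b} → P (a ∙ b) ⇔ (P a × P b)) → ∀ as bs →
                             Any P (cartesianProductWith _∙_ as bs) ⇔ (Any P as × Any P bs)
  Any-cartesianProductWith ∙⇔× as bs = mk⇔
    (Any.cartesianProductWith⁻ _∙_ (to ∙⇔×) as bs)
    (uncurry (Any.cartesianProductWith⁺ _∙_ (curry (from ∙⇔×))))

  All-cartesianProductWith : Decidable P → (∀ {a b} → P (a ∙ b) ⇔ (P a ⊎ P b)) → ∀ as bs →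
                             All P (cartesianProductWith _∙_ as bs) ⇔ (All P as ⊎ All P bs)
  All-cartesianProductWith P? ∙⇔⊎ as bs = mk⇔ (split as) (join as)
    where
    split : ∀ as → All P (cartesianProductWith _∙_ as bs) → All P as ⊎ All P bs
    split []       _ = inj₁ []
    split (a ∷ as) h with All.++⁻ (map (a ∙_) bs) h | P? a
    ... | _    , rest | yes pa = Sum.map₁ (pa ∷_) (split as rest)
    ... | a∙bs , _    | no ¬pa =
      inj₂ (All.map ([ (λ pa → contradiction pa ¬pa) , id ]′ ∘ to ∙⇔⊎) (All.map⁻ a∙bs))
    join : ∀ as → All P as ⊎ All P bs → All P (cartesianProductWith _∙_ as bs)
    join []       _                 = []
    join (a ∷ as) (inj₁ (pa ∷ pas)) =
      All.++⁺ (All.map⁺ (All.universal (λ _ → from ∙⇔⊎ (inj₁ pa)) bs)) (join as (inj₁ pas))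
    join (a ∷ as) (inj₂ pbs)        =
      All.++⁺ (All.map⁺ (All.map (from ∙⇔⊎ ∘ inj₂) pbs)) (join as (inj₂ pbs))

rel? : ∀ β a b → Dec (⟦ β ⟧β a b)
rel? le    a b = a ℕ.≤? b
rel? lt    a b = a ℕ.<? b
rel? succ  a b = b ℕ.≟ suc a
rel? nsucc a b = ¬? (b ℕ.≟ suc a)
rel? eq    a b = a ℕ.≟ b
rel? neq   a b = ¬? (a ℕ.≟ b)

rel-shift : ∀ β a b → ⟦ β ⟧β (suc a) (suc b) ⇔ ⟦ β ⟧β a b
rel-shift le    a b = mk⇔ s≤s⁻¹ s≤s
rel-shift lt    a b = mk⇔ s<s⁻¹ s<s
rel-shift succ  a b = mk⇔ suc-injective (cong suc)
rel-shift nsucc a b = ¬-cong-⇔ (rel-shift succ a b)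
rel-shift eq    a b = mk⇔ suc-injective (cong suc)
rel-shift neq   a b = ¬-cong-⇔ (rel-shift eq a b)

rel-far-after : ∀ β b → ⟦ β ⟧β 0 (2 ℕ.+ b) ⇔ ⟦ β ⟧β 0 2
rel-far-after le    b = mk⇔ (λ _ → z≤n) (λ _ → z≤n)
rel-far-after lt    b = mk⇔ (λ _ → z<s) (λ _ → z<s)
rel-far-after succ  b = mk⇔ (λ ()) (λ ())
rel-far-after nsucc b = mk⇔ (λ _ ()) (λ _ ())
rel-far-after eq    b = mk⇔ (λ ()) (λ ())
rel-far-after neq   b = mk⇔ (λ _ ()) (λ _ ())

rel-far-before : ∀ β a → ⟦ β ⟧β (2 ℕ.+ a) 0 ⇔ ⟦ β ⟧β 2 0
rel-far-before le    a = mk⇔ (λ ()) (λ ())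
rel-far-before lt    a = mk⇔ (λ ()) (λ ())
rel-far-before succ  a = mk⇔ (λ ()) (λ ())
rel-far-before nsucc a = mk⇔ (λ _ ()) (λ _ ())
rel-far-before eq    a = mk⇔ (λ ()) (λ ())
rel-far-before neq   a = mk⇔ (λ _ ()) (λ _ ())

data Offset : Set where
  before₂ before₁ same after₁ after₂ : Offset

HasOffset : Offset → ℕ → ℕ → Set
HasOffset before₂ a b = suc b ℕ.< a
HasOffset before₁ a b = a ≡ suc b
HasOffset same    a b = b ≡ a
HasOffset after₁  a b = b ≡ suc a
HasOffset after₂  a b = suc a ℕ.< b

offset : ℕ → ℕ → Offset
offset zero          zero          = same
offset zero          (suc zero)    = after₁
offset zero          (suc (suc _)) = after₂
offset (suc a)       (suc b)       = offset a b
offset (suc zero)    zero          = before₁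
offset (suc (suc _)) zero          = before₂

HasOffset-suc : ∀ c {a b} → HasOffset c a b → HasOffset c (suc a) (suc b)
HasOffset-suc before₂ h = s<s h
HasOffset-suc before₁ h = cong suc h
HasOffset-suc same    h = cong suc h
HasOffset-suc after₁  h = cong suc h
HasOffset-suc after₂  h = s<s h

offset-sound : ∀ a b → HasOffset (offset a b) a b
offset-sound zero          zero          = refl
offset-sound zero          (suc zero)    = refl
offset-sound zero          (suc (suc b)) = s<s z<s
offset-sound (suc a)       (suc b)       = HasOffset-suc (offset a b) (offset-sound a b)
offset-sound (suc zero)    zero          = refl
offset-sound (suc (suc a)) zero          = s<s z<s

offset-unique : ∀ c a b → HasOffset c a b → offset a b ≡ c
offset-unique before₂ _       zero    (s<s (s<s z≤n)) = refl
offset-unique before₂ (suc a) (suc b) (s<s h)         = offset-unique before₂ a b h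
offset-unique before₁ _       zero    refl            = refl
offset-unique before₁ _       (suc b) refl            = offset-unique before₁ (suc b) b refl
offset-unique same    zero    _       refl            = refl
offset-unique same    (suc a) _       refl            = offset-unique same a a refl
offset-unique after₁  zero    _       refl            = refl
offset-unique after₁  (suc a) _       refl            = offset-unique after₁ a (suc a) refl
offset-unique after₂  zero    _       (s<s (s<s z≤n)) = refl
offset-unique after₂  (suc a) (suc b) (s<s h)         = offset-unique after₂ a b h

offset-refl : ∀ a → offset a a ≡ same
offset-refl a = offset-unique same a a refl

mirror : Offset → Offset
mirror before₂ = after₂
mirror before₁ = after₁
mirror same    = same
mirror after₁  = before₁
mirror after₂  = before₂

offset-flip : ∀ a b → offset b a ≡ mirror (offset a b)
offset-flip zero          zero          = refl
offset-flip zero          (suc zero)    = refl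
offset-flip zero          (suc (suc b)) = refl
offset-flip (suc a)       (suc b)       = offset-flip a b
offset-flip (suc zero)    zero          = refl
offset-flip (suc (suc a)) zero          = refl

canonical : Offset → ℕ × ℕ
canonical before₂ = 2 , 0
canonical before₁ = 1 , 0
canonical same    = 0 , 0
canonical after₁  = 0 , 1
canonical after₂  = 0 , 2

RelAt : BinRel → Offset → Set
RelAt β c = uncurry ⟦ β ⟧β (canonical c)

relAt? : ∀ β c → Dec (RelAt β c)
relAt? β c = uncurry (rel? β) (canonical c)

rel-offset : ∀ β a b → ⟦ β ⟧β a b ⇔ RelAt β (offset a b)
rel-offset β zero          zero          = ⇔.refl
rel-offset β zero          (suc zero)    = ⇔.refl
rel-offset β zero          (suc (suc b)) = rel-far-after β b
rel-offset β (suc a)       (suc b)       = ⇔.trans (rel-shift β a b) (rel-offset β a b)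
rel-offset β (suc zero)    zero          = ⇔.refl
rel-offset β (suc (suc a)) zero          = rel-far-before β a

between : Var → Var → Offset → Offset
between x x _ = same
between x y c = c
between y x c = mirror c
between y y _ = same

offset-between : ∀ (σ : Var → ℕ) v w → offset (σ v) (σ w) ≡ between v w (offset (σ x) (σ y))
offset-between σ x x = offset-refl (σ x)
offset-between σ x y = refl
offset-between σ y x = offset-flip (σ x) (σ y)
offset-between σ y y = offset-refl (σ y)

rel-between : ∀ β (σ : Var → ℕ) v w → ⟦ β ⟧β (σ v) (σ w) ⇔ RelAt β (between v w (offset (σ x) (σ y)))
rel-between β σ v w =
  subst (λ c → ⟦ β ⟧β (σ v) (σ w) ⇔ RelAt β c) (offset-between σ v w) (rel-offset β (σ v) (σ w))

Σ-by-offset : ∀ {J : Set} a (f : J → ℕ) {Q : J → Offset → Set} →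
              (Σ J λ j → Q j (offset a (f j))) ⇔ (Σ Offset λ c → Σ J λ j → HasOffset c a (f j) × Q j c)
Σ-by-offset a f {Q} = mk⇔
  (λ (j , q) → offset a (f j) , j , offset-sound a (f j) , q)
  (λ (c , j , h , q) → j , subst (Q j) (sym (offset-unique c a (f j) h)) q)

Π-by-offset : ∀ {J : Set} a (f : J → ℕ) {Q : J → Offset → Set} →
              (∀ j → Q j (offset a (f j))) ⇔ (∀ c j → HasOffset c a (f j) → Q j c)
Π-by-offset a f {Q} = mk⇔
  (λ q c j h → subst (Q j) (offset-unique c a (f j) h) (q j))
  (λ q j → q (offset a (f j)) j (offset-sound a (f j)))

Models? : ∀ {n} (u : Word n) (i : Pos u) (ψ : UTL n) → Dec (Models u i ψ)
Models? u i ⊥'       = no λ ()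
Models? u i ⊤'       = yes tt
Models? u i (atom a) = lookup u i a Bool.≟ true
Models? u i (φ ∧' ψ) = Models? u i φ ×-dec Models? u i ψ
Models? u i (φ ∨' ψ) = Models? u i φ ⊎-dec Models? u i ψ
Models? u i (X ψ)    = any? λ j → (toℕ j ℕ.≟ suc (toℕ i)) ×-dec Models? u j ψ
Models? u i (Y ψ)    = any? λ j → (toℕ i ℕ.≟ suc (toℕ j)) ×-dec Models? u j ψ
Models? u i (P ψ)    = any? λ j → (j Fin.<? i) ×-dec Models? u j ψ
Models? u i (F ψ)    = any? λ j → (i Fin.<? j) ×-dec Models? u j ψ
Models? u i (H ψ)    = all? λ j → (j Fin.<? i) →-dec Models? u j ψ
Models? u i (G ψ)    = all? λ j → (i Fin.<? j) →-dec Models? u j ψ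

truthOf : ∀ {n} {A : Set} → Dec A → UTL n
truthOf (yes _) = ⊤'
truthOf (no _)  = ⊥'

Models-truthOf : ∀ {n} {A : Set} (u : Word n) i (d : Dec A) → Models u i (truthOf d) ⇔ A
Models-truthOf u i (yes a) = mk⇔ (λ _ → a) (λ _ → tt)
Models-truthOf u i (no ¬a) = mk⇔ (λ ()) ¬a

◇ □ : ∀ {n} → Offset → UTL n → UTL n
◇ before₂ β = Y (P β)
◇ before₁ β = Y β
◇ same    β = β
◇ after₁  β = X β
◇ after₂  β = X (F β)

-- H ⊥' and G ⊥' hold exactly at the first and the last position, where Y and X fail.
□ before₂ β = Y (H β) ∨' H ⊥'
□ before₁ β = Y β ∨' H ⊥'
□ same    β = β
□ after₁  β = X β ∨' G ⊥'
□ after₂  β = X (G β) ∨' G ⊥'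

UTL² : ℕ → Set
UTL² n = UTL n × UTL n

_∧²_ _∨²_ : ∀ {n} → UTL² n → UTL² n → UTL² n
(α , β) ∧² (α′ , β′) = α ∧' α′ , β ∧' β′
(α , β) ∨² (α′ , β′) = α ∨' α′ , β ∨' β′

swapped : ∀ {n} → (Offset → List (UTL² n)) → Offset → List (UTL² n)
swapped D c = map swap (D (mirror c))

◇-terms : ∀ {n} → Offset → List (UTL² n) → UTL n
◇-terms c []             = ⊥'
◇-terms c ((α , β) ∷ ts) = (α ∧' ◇ c β) ∨' ◇-terms c ts

□-clauses : ∀ {n} → Offset → List (UTL² n) → UTL n
□-clauses c []             = ⊤'
□-clauses c ((α , β) ∷ cs) = (α ∨' □ c β) ∧' □-clauses c cs

⋁-offsets ⋀-offsets : ∀ {n} → (Offset → UTL n) → UTL n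
⋁-offsets f = f before₂ ∨' (f before₁ ∨' (f same ∨' (f after₁ ∨' f after₂)))
⋀-offsets f = f before₂ ∧' (f before₁ ∧' (f same ∧' (f after₁ ∧' f after₂)))

exists-y forall-y : ∀ {n} → (Offset → List (UTL² n)) → UTL n
exists-y D = ⋁-offsets λ c → ◇-terms c (D c)
forall-y C = ⋀-offsets λ c → □-clauses c (C c)

module _ {n : ℕ} (u : Word n) where
  private
    _⊨_ : Pos u → UTL n → Set
    i ⊨ ψ = Models u i ψ

  ◇-correct : ∀ c (i : Pos u) β → (Σ (Pos u) λ j → HasOffset c (toℕ i) (toℕ j) × j ⊨ β) ⇔ i ⊨ ◇ c β
  ◇-correct before₂ i β = mk⇔
    (λ (j , 1+j<i , j⊨β) → let (k , i≡1+k) = prev i j (<⇒≤ 1+j<i) in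
      k , i≡1+k , j , s<s⁻¹ (subst (suc (toℕ j) ℕ.<_) i≡1+k 1+j<i) , j⊨β)
    (λ (k , i≡1+k , j , j<k , j⊨β) → j , subst (suc (toℕ j) ℕ.<_) (sym i≡1+k) (s<s j<k) , j⊨β)
  ◇-correct before₁ i β = ⇔.refl
  ◇-correct same    i β = mk⇔
    (λ (j , j≡i , j⊨β) → subst (_⊨ β) (toℕ-injective j≡i) j⊨β)
    (λ i⊨β → i , refl , i⊨β)
  ◇-correct after₁  i β = ⇔.refl
  ◇-correct after₂  i β = mk⇔
    (λ (j , 1+i<j , j⊨β) → let (k , k≡1+i) = next i j (<⇒≤ 1+i<j) in
      k , k≡1+i , j , subst (ℕ._< toℕ j) (sym k≡1+i) 1+i<j , j⊨β)
    (λ (k , k≡1+i , j , k<j , j⊨β) → j , subst (ℕ._< toℕ j) k≡1+i k<j , j⊨β)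

  □-correct : ∀ c (i : Pos u) β → (∀ j → HasOffset c (toℕ i) (toℕ j) → j ⊨ β) ⇔ i ⊨ □ c β
  □-correct before₂ i β = mk⇔
    (λ h → Sum.map₁ (λ (k , i≡1+k) → k , i≡1+k , λ j j<k →
                       h j (subst (suc (toℕ j) ℕ.<_) (sym i≡1+k) (s<s j<k)))
                    (prev-or-first i))
    λ { (inj₁ (k , i≡1+k , k⊨Hβ)) j 1+j<i → k⊨Hβ j (s<s⁻¹ (subst (suc (toℕ j) ℕ.<_) i≡1+k 1+j<i))
      ; (inj₂ first)              j 1+j<i → contradiction (<⇒≤ 1+j<i) (first j) }
  □-correct before₁ i β = mk⇔
    (λ h → Sum.map₁ (λ (k , i≡1+k) → k , i≡1+k , h k i≡1+k) (prev-or-first i))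
    λ { (inj₁ (k , i≡1+k , k⊨β)) j i≡1+j →
          subst (_⊨ β) (toℕ-injective (suc-injective (trans (sym i≡1+k) i≡1+j))) k⊨β
      ; (inj₂ first)             j i≡1+j → contradiction (≤-reflexive (sym i≡1+j)) (first j) }
  □-correct same    i β = mk⇔
    (λ h → h i refl)
    (λ i⊨β j j≡i → subst (_⊨ β) (sym (toℕ-injective j≡i)) i⊨β)
  □-correct after₁  i β = mk⇔
    (λ h → Sum.map₁ (λ (k , k≡1+i) → k , k≡1+i , h k k≡1+i) (next-or-last i))
    λ { (inj₁ (k , k≡1+i , k⊨β)) j j≡1+i → subst (_⊨ β) (toℕ-injective (trans k≡1+i (sym j≡1+i))) k⊨β
      ; (inj₂ last)              j j≡1+i → contradiction (≤-reflexive (sym j≡1+i)) (last j) }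
  □-correct after₂  i β = mk⇔
    (λ h → Sum.map₁ (λ (k , k≡1+i) → k , k≡1+i , λ j k<j → h j (subst (ℕ._< toℕ j) k≡1+i k<j))
                    (next-or-last i))
    λ { (inj₁ (k , k≡1+i , k⊨Gβ)) j 1+i<j → k⊨Gβ j (subst (ℕ._< toℕ j) (sym k≡1+i) 1+i<j)
      ; (inj₂ last)               j 1+i<j → contradiction (<⇒≤ 1+i<j) (last j) }

  Both Either : Pos u → Pos u → UTL² n → Set
  Both   i j (α , β) = i ⊨ α × j ⊨ β
  Either i j (α , β) = i ⊨ α ⊎ j ⊨ β

  Both-∧² : ∀ i j {p q} → Both i j (p ∧² q) ⇔ (Both i j p × Both i j q)
  Both-∧² i j = mk⇔ interchange interchange
    where
    interchange : ∀ {A B C D : Set} → (A × B) × (C × D) → (A × C) × (B × D)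
    interchange ((a , b) , (c , d)) = (a , c) , (b , d)

  Either-∨² : ∀ i j {p q} → Either i j (p ∨² q) ⇔ (Either i j p ⊎ Either i j q)
  Either-∨² i j = mk⇔ interchange interchange
    where
    interchange : ∀ {A B C D : Set} → (A ⊎ B) ⊎ (C ⊎ D) → (A ⊎ C) ⊎ (B ⊎ D)
    interchange = [ Sum.map inj₁ inj₁ , Sum.map inj₂ inj₂ ]′

  Either? : ∀ i j → Decidable (Either i j)
  Either? i j (α , β) = Models? u i α ⊎-dec Models? u j β

  Any-Both-swapped : ∀ D (i j : Pos u) →
                     Any (Both j i) (D (offset (toℕ j) (toℕ i)))
                     ⇔ Any (Both i j) (swapped D (offset (toℕ i) (toℕ j)))
  Any-Both-swapped D i j rewrite offset-flip (toℕ i) (toℕ j) =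
    mk⇔ (Any.map⁺ ∘ Any.map swap) (Any.map swap ∘ Any.map⁻)

  All-Either-swapped : ∀ C (i j : Pos u) →
                       All (Either j i) (C (offset (toℕ j) (toℕ i)))
                       ⇔ All (Either i j) (swapped C (offset (toℕ i) (toℕ j)))
  All-Either-swapped C i j rewrite offset-flip (toℕ i) (toℕ j) =
    mk⇔ (All.map⁺ ∘ All.map Sum.swap) (All.map Sum.swap ∘ All.map⁻)

  Models-⋁-offsets : ∀ {i} f → i ⊨ ⋁-offsets f ⇔ (Σ Offset λ c → i ⊨ f c)
  Models-⋁-offsets f = mk⇔
    (λ { (inj₁ m)                      → before₂ , m
       ; (inj₂ (inj₁ m))               → before₁ , m
       ; (inj₂ (inj₂ (inj₁ m)))        → same , m
       ; (inj₂ (inj₂ (inj₂ (inj₁ m)))) → after₁ , m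
       ; (inj₂ (inj₂ (inj₂ (inj₂ m)))) → after₂ , m })
    (λ { (before₂ , m) → inj₁ m
       ; (before₁ , m) → inj₂ (inj₁ m)
       ; (same    , m) → inj₂ (inj₂ (inj₁ m))
       ; (after₁  , m) → inj₂ (inj₂ (inj₂ (inj₁ m)))
       ; (after₂  , m) → inj₂ (inj₂ (inj₂ (inj₂ m))) })

  Models-⋀-offsets : ∀ {i} f → i ⊨ ⋀-offsets f ⇔ (∀ c → i ⊨ f c)
  Models-⋀-offsets f = mk⇔
    (λ { (m , _ , _ , _ , _) before₂ → m
       ; (_ , m , _ , _ , _) before₁ → m
       ; (_ , _ , m , _ , _) same    → m
       ; (_ , _ , _ , m , _) after₁  → m
       ; (_ , _ , _ , _ , m) after₂  → m })
    (λ h → h before₂ , h before₁ , h same , h after₁ , h after₂)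

  ◇-terms-correct : ∀ c i ts →
                    (Σ (Pos u) λ j → HasOffset c (toℕ i) (toℕ j) × Any (Both i j) ts) ⇔ i ⊨ ◇-terms c ts
  ◇-terms-correct c i []             = mk⇔ (λ ()) (λ ())
  ◇-terms-correct c i ((α , β) ∷ ts) = mk⇔
    (λ { (j , h , here (i⊨α , j⊨β)) → inj₁ (i⊨α , to (◇-correct c i β) (j , h , j⊨β))
       ; (j , h , there t)          → inj₂ (to (◇-terms-correct c i ts) (j , h , t)) })
    (λ { (inj₁ (i⊨α , i⊨◇β)) → let (j , h , j⊨β) = from (◇-correct c i β) i⊨◇β in j , h , here (i⊨α , j⊨β)
       ; (inj₂ i⊨◇ts)        → let (j , h , t) = from (◇-terms-correct c i ts) i⊨◇ts in j , h , there t })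

  □-clauses-correct : ∀ c i cs →
                      (∀ j → HasOffset c (toℕ i) (toℕ j) → All (Either i j) cs) ⇔ i ⊨ □-clauses c cs
  □-clauses-correct c i []             = mk⇔ (λ _ → tt) (λ _ _ _ → [])
  □-clauses-correct c i ((α , β) ∷ cs) = mk⇔
    (λ h → Sum.map₂ (to (□-correct c i β) ∘ curry)
                    (∀-⊎-distribˡ (Models? u i α) (λ (j , hj) → All.head (h j hj)))
         , to (□-clauses-correct c i cs) (λ j hj → All.tail (h j hj)))
    (λ (i⊨α∨□β , i⊨□cs) j hj →
      Sum.map₂ (λ i⊨□β → from (□-correct c i β) i⊨□β j hj) i⊨α∨□β
      ∷ from (□-clauses-correct c i cs) i⊨□cs j hj)

  exists-y-correct : ∀ D i → (Σ (Pos u) λ j → Any (Both i j) (D (offset (toℕ i) (toℕ j)))) ⇔ i ⊨ exists-y D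
  exists-y-correct D i =
    ⇔.trans (Σ-by-offset (toℕ i) toℕ)
      (⇔.trans (Σ.congˡ λ {c} → ◇-terms-correct c i (D c)) (⇔.sym (Models-⋁-offsets _)))

  forall-y-correct : ∀ C i → (∀ j → All (Either i j) (C (offset (toℕ i) (toℕ j)))) ⇔ i ⊨ forall-y C
  forall-y-correct C i =
    ⇔.trans (Π-by-offset (toℕ i) toℕ {λ j c → All (Either i j) (C c)})
      (⇔.trans (Π-cong λ c → □-clauses-correct c i (C c)) (⇔.sym (Models-⋀-offsets _)))

offsetOf : ∀ {m} → (Var → Fin m) → Offset
offsetOf ρ = offset (toℕ (ρ x)) (toℕ (ρ y))

record NormalForms {n} (φ : FO2 n) : Set where
  field
    dnf cnf     : Offset → List (UTL² n)
    dnf-correct : ∀ (u : Word n) ρ → Sat u ρ φ ⇔ Any (Both u (ρ x) (ρ y)) (dnf (offsetOf ρ))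
    cnf-correct : ∀ (u : Word n) ρ → Sat u ρ φ ⇔ All (Either u (ρ x) (ρ y)) (cnf (offsetOf ρ))

open NormalForms

literal : ∀ {n} {φ : FO2 n} v (θ : Offset → UTL n) →
          (∀ u ρ → Sat u ρ φ ⇔ Models u (ρ v) (θ (offsetOf ρ))) → NormalForms φ
literal x θ φ⇔θ = record
  { dnf         = λ c → (θ c , ⊤') ∷ []
  ; cnf         = λ c → (θ c , ⊥') ∷ []
  ; dnf-correct = λ u ρ → ⇔.trans (φ⇔θ u ρ) (mk⇔ (λ m → here (m , tt)) λ { (here (m , _)) → m })
  ; cnf-correct = λ u ρ → ⇔.trans (φ⇔θ u ρ)
                            (mk⇔ (λ m → inj₁ m ∷ []) λ { (inj₁ m ∷ []) → m ; (inj₂ () ∷ []) })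
  }
literal y θ φ⇔θ = record
  { dnf         = λ c → (⊤' , θ c) ∷ []
  ; cnf         = λ c → (⊥' , θ c) ∷ []
  ; dnf-correct = λ u ρ → ⇔.trans (φ⇔θ u ρ) (mk⇔ (λ m → here (tt , m)) λ { (here (_ , m)) → m })
  ; cnf-correct = λ u ρ → ⇔.trans (φ⇔θ u ρ)
                            (mk⇔ (λ m → inj₂ m ∷ []) λ { (inj₂ m ∷ []) → m ; (inj₁ () ∷ []) })
  }

module _ {n} {φ ψ : FO2 n} (N : NormalForms φ) (M : NormalForms ψ) where

  conjunction : NormalForms (φ ∧' ψ)
  conjunction = record
    { dnf         = λ c → cartesianProductWith _∧²_ (dnf N c) (dnf M c)
    ; cnf         = λ c → cnf N c ++ cnf M c
    ; dnf-correct = λ u ρ → ⇔.trans (dnf-correct N u ρ ×-cong dnf-correct M u ρ)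
                              (⇔.sym (Any-cartesianProductWith _∧²_ (Both-∧² u (ρ x) (ρ y)) _ _))
    ; cnf-correct = λ u ρ → ⇔.trans (cnf-correct N u ρ ×-cong cnf-correct M u ρ) (↔⇒⇔ All.++↔)
    }

  disjunction : NormalForms (φ ∨' ψ)
  disjunction = record
    { dnf         = λ c → dnf N c ++ dnf M c
    ; cnf         = λ c → cartesianProductWith _∨²_ (cnf N c) (cnf M c)
    ; dnf-correct = λ u ρ → ⇔.trans (dnf-correct N u ρ ⊎-cong dnf-correct M u ρ) (↔⇒⇔ Any.++↔)
    ; cnf-correct = λ u ρ → ⇔.trans (cnf-correct N u ρ ⊎-cong cnf-correct M u ρ)
                              (⇔.sym (All-cartesianProductWith _∨²_ (Either? u (ρ x) (ρ y))
                                                                    (Either-∨² u (ρ x) (ρ y)) _ _))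
    }

module _ {n} {φ : FO2 n} (N : NormalForms φ) (u : Word n) (ρ : Var → Pos u) where

  ∃y-correct : Sat u ρ (∃' y φ) ⇔ Models u (ρ x) (exists-y (dnf N))
  ∃y-correct = ⇔.trans (Σ.congˡ λ {j} → dnf-correct N u (update ρ y j)) (exists-y-correct u (dnf N) (ρ x))

  ∃x-correct : Sat u ρ (∃' x φ) ⇔ Models u (ρ y) (exists-y (swapped (dnf N)))
  ∃x-correct =
    ⇔.trans (Σ.congˡ λ {j} → ⇔.trans (dnf-correct N u (update ρ x j)) (Any-Both-swapped u (dnf N) (ρ y) j))
            (exists-y-correct u (swapped (dnf N)) (ρ y))

  ∀y-correct : Sat u ρ (∀' y φ) ⇔ Models u (ρ x) (forall-y (cnf N))
  ∀y-correct = ⇔.trans (Π-cong λ j → cnf-correct N u (update ρ y j)) (forall-y-correct u (cnf N) (ρ x))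

  ∀x-correct : Sat u ρ (∀' x φ) ⇔ Models u (ρ y) (forall-y (swapped (cnf N)))
  ∀x-correct =
    ⇔.trans (Π-cong λ j → ⇔.trans (cnf-correct N u (update ρ x j)) (All-Either-swapped u (cnf N) (ρ y) j))
            (forall-y-correct u (swapped (cnf N)) (ρ y))

normalForms : ∀ {n} (φ : FO2 n) → NormalForms φ
normalForms ⊥'          = literal x (λ _ → ⊥') λ _ _ → ⇔.refl
normalForms ⊤'          = literal x (λ _ → ⊤') λ _ _ → ⇔.refl
normalForms (rel β v w) = literal x (λ c → truthOf (relAt? β (between v w c)))
  λ u ρ → ⇔.trans (rel-between β (toℕ ∘ ρ) v w) (⇔.sym (Models-truthOf u (ρ x) _))
normalForms (pred a v)  = literal v (λ _ → atom a) λ _ _ → ⇔.refl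
normalForms (φ ∧' ψ)    = conjunction (normalForms φ) (normalForms ψ)
normalForms (φ ∨' ψ)    = disjunction (normalForms φ) (normalForms ψ)
normalForms (∃' x φ)    = literal y (λ _ → exists-y (swapped (dnf (normalForms φ)))) (∃x-correct (normalForms φ))
normalForms (∃' y φ)    = literal x (λ _ → exists-y (dnf (normalForms φ))) (∃y-correct (normalForms φ))
normalForms (∀' x φ)    = literal y (λ _ → forall-y (swapped (cnf (normalForms φ)))) (∀x-correct (normalForms φ))
normalForms (∀' y φ)    = literal x (λ _ → forall-y (cnf (normalForms φ))) (∀y-correct (normalForms φ))

update-agree : ∀ {A : Set} {ρ ρ′ : Var → A} w a v → (v ≢ w → ρ v ≡ ρ′ v) → update ρ w a v ≡ update ρ′ w a v
update-agree x _ x _  = refl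
update-agree x _ y ρ≡ = ρ≡ λ ()
update-agree y _ x ρ≡ = ρ≡ λ ()
update-agree y _ y _  = refl

Sat-agree : ∀ {n} (u : Word n) (φ : FO2 n) {ρ ρ′ : Var → Pos u} →
            (∀ v → FreeIn v φ → ρ v ≡ ρ′ v) → Sat u ρ φ → Sat u ρ′ φ
Sat-agree u ⊤'          ρ≡ _        = tt
Sat-agree u (rel β v w) ρ≡ s        = subst₂ (λ i j → ⟦ β ⟧β (toℕ i) (toℕ j)) (ρ≡ v rel₁) (ρ≡ w rel₂) s
Sat-agree u (pred a v)  ρ≡ s        = subst (holds u a) (ρ≡ v pred) s
Sat-agree u (φ ∧' ψ)    ρ≡ (s , t)  = Sat-agree u φ (λ v → ρ≡ v ∘ ∧₁) s , Sat-agree u ψ (λ v → ρ≡ v ∘ ∧₂) t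
Sat-agree u (φ ∨' ψ)    ρ≡ (inj₁ s) = inj₁ (Sat-agree u φ (λ v → ρ≡ v ∘ ∨₁) s)
Sat-agree u (φ ∨' ψ)    ρ≡ (inj₂ t) = inj₂ (Sat-agree u ψ (λ v → ρ≡ v ∘ ∨₂) t)
Sat-agree u (∃' w φ)    ρ≡ (j , s)  = j , Sat-agree u φ (λ v f → update-agree w j v λ v≢w → ρ≡ v (∃f v≢w f)) s
Sat-agree u (∀' w φ)    ρ≡ s j      = Sat-agree u φ (λ v f → update-agree w j v λ v≢w → ρ≡ v (∀f v≢w f)) (s j)

∃y-vacuous : ∀ {n} {φ : FO2 n} → OneFree φ → ∀ u ρ → Sat u ρ φ ⇔ Sat u ρ (∃' y φ)
∃y-vacuous {φ = φ} y∉φ u ρ = mk⇔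
  (λ s → ρ y , Sat-agree u φ (λ { x _ → refl ; y _ → refl }) s)
  (λ (j , s) → Sat-agree u φ (λ { x _ → refl ; y y∈φ → contradiction y∈φ y∉φ }) s)

fo2⇒utl : ∀ {n} (φ : FO2 n) → OneFree φ →
          Σ (UTL n) λ ψ → ∀ (u : Word n) (ρ : Var → Pos u) → Sat u ρ φ ⇔ Models u (ρ x) ψ
fo2⇒utl φ y∉φ =
  exists-y (dnf (normalForms φ)) , λ u ρ → ⇔.trans (∃y-vacuous y∉φ u ρ) (∃y-correct (normalForms φ) u ρ)

other : Var → Var
other x = y
other y = x

≢other⇒≡ : ∀ {v w} → w ≢ other v → w ≡ v
≢other⇒≡ {x} {x} _   = refl
≢other⇒≡ {x} {y} w≢y = contradiction refl w≢y
≢other⇒≡ {y} {x} w≢x = contradiction refl w≢x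
≢other⇒≡ {y} {y} _   = refl

ST : ∀ {n} → Var → UTL n → FO2 n
ST v ⊥'       = ⊥'
ST v ⊤'       = ⊤'
ST v (atom a) = pred a v
ST v (φ ∧' ψ) = ST v φ ∧' ST v ψ
ST v (φ ∨' ψ) = ST v φ ∨' ST v ψ
ST v (X φ)    = ∃' (other v) (rel succ v (other v) ∧' ST (other v) φ)
ST v (Y φ)    = ∃' (other v) (rel succ (other v) v ∧' ST (other v) φ)
ST v (P φ)    = ∃' (other v) (rel lt (other v) v ∧' ST (other v) φ)
ST v (F φ)    = ∃' (other v) (rel lt v (other v) ∧' ST (other v) φ)
ST v (H φ)    = ∀' (other v) (rel le v (other v) ∨' ST (other v) φ)
ST v (G φ)    = ∀' (other v) (rel le (other v) v ∨' ST (other v) φ)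

ST-free : ∀ {n} v (ψ : UTL n) {w} → FreeIn w (ST v ψ) → w ≡ v
ST-free v (atom a) pred      = refl
ST-free v (φ ∧' ψ) (∧₁ f)    = ST-free v φ f
ST-free v (φ ∧' ψ) (∧₂ f)    = ST-free v ψ f
ST-free v (φ ∨' ψ) (∨₁ f)    = ST-free v φ f
ST-free v (φ ∨' ψ) (∨₂ f)    = ST-free v ψ f
ST-free v (X φ)    (∃f w≢ _) = ≢other⇒≡ w≢
ST-free v (Y φ)    (∃f w≢ _) = ≢other⇒≡ w≢
ST-free v (P φ)    (∃f w≢ _) = ≢other⇒≡ w≢
ST-free v (F φ)    (∃f w≢ _) = ≢other⇒≡ w≢
ST-free v (H φ)    (∀f w≢ _) = ≢other⇒≡ w≢
ST-free v (G φ)    (∀f w≢ _) = ≢other⇒≡ w≢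

ST-correct : ∀ {n} v (ψ : UTL n) (u : Word n) ρ → Sat u ρ (ST v ψ) ⇔ Models u (ρ v) ψ
ST-correct v ⊥'       u ρ = ⇔.refl
ST-correct v ⊤'       u ρ = ⇔.refl
ST-correct v (atom a) u ρ = ⇔.refl
ST-correct v (φ ∧' ψ) u ρ = ST-correct v φ u ρ ×-cong ST-correct v ψ u ρ
ST-correct v (φ ∨' ψ) u ρ = ST-correct v φ u ρ ⊎-cong ST-correct v ψ u ρ
ST-correct x (X ψ)    u ρ = Σ.congˡ (⇔.refl ×-cong ST-correct y ψ u _)
ST-correct y (X ψ)    u ρ = Σ.congˡ (⇔.refl ×-cong ST-correct x ψ u _)
ST-correct x (Y ψ)    u ρ = Σ.congˡ (⇔.refl ×-cong ST-correct y ψ u _)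
ST-correct y (Y ψ)    u ρ = Σ.congˡ (⇔.refl ×-cong ST-correct x ψ u _)
ST-correct x (P ψ)    u ρ = Σ.congˡ (⇔.refl ×-cong ST-correct y ψ u _)
ST-correct y (P ψ)    u ρ = Σ.congˡ (⇔.refl ×-cong ST-correct x ψ u _)
ST-correct x (F ψ)    u ρ = Σ.congˡ (⇔.refl ×-cong ST-correct y ψ u _)
ST-correct y (F ψ)    u ρ = Σ.congˡ (⇔.refl ×-cong ST-correct x ψ u _)
ST-correct x (H ψ)    u ρ = Π-cong λ j → ⇔.trans (⇔.refl ⊎-cong ST-correct y ψ u _) (≤-⊎⇔<-→ _ _)
ST-correct y (H ψ)    u ρ = Π-cong λ j → ⇔.trans (⇔.refl ⊎-cong ST-correct x ψ u _) (≤-⊎⇔<-→ _ _)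
ST-correct x (G ψ)    u ρ = Π-cong λ j → ⇔.trans (⇔.refl ⊎-cong ST-correct y ψ u _) (≤-⊎⇔<-→ _ _)
ST-correct y (G ψ)    u ρ = Π-cong λ j → ⇔.trans (⇔.refl ⊎-cong ST-correct x ψ u _) (≤-⊎⇔<-→ _ _)

utl⇒fo2 : ∀ {n} (ψ : UTL n) →
          Σ (FO2 n) λ φ → OneFree φ × (∀ (u : Word n) (ρ : Var → Pos u) → Sat u ρ φ ⇔ Models u (ρ x) ψ)
utl⇒fo2 ψ = ST x ψ , (λ y-free → case ST-free x ψ y-free of λ ()) , ST-correct x ψ

theorem26 : (n : ℕ)
    → ((φ : FO2 n) → OneFree φ
        → Σ (UTL n) λ ψ → ∀ (u : Word n) (ρ : Var → Pos u) → Sat u ρ φ ⇔ Models u (ρ x) ψ)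
    × ((ψ : UTL n)
        → Σ (FO2 n) λ φ → OneFree φ × (∀ (u : Word n) (ρ : Var → Pos u) → Sat u ρ φ ⇔ Models u (ρ x) ψ))
theorem26 n = fo2⇒utl , utl⇒fo2
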